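{- The set of diagonal matrices in $\mathrm{Par}_n$ is the image under $\Phi$ of the set of $w\in\mathcal I_n$ for which there exist $k\ge1$ and positive integers $u_1,\dots,u_k$ with $u_1+\dots+u_k=n$ such that $\mathrm{RLE}(w)=(p_0,u_1)(p_1,u_2)\cdots(p_{k-1},u_k)$, where $p_0=0$ and $p_j=u_1+\dots+u_j$ for $j\ge1$; equivalently, $w$ consists of $u_1$ copies of $p_0$, followed by $u_2$ copies of $p_1$, \dots, followed by $u_k$ copies of $p_{k-1}$.
   Context: $[a,b]=\{i\in\mathbb Z:a\le i\le b\}$. $\mathcal I_n$ is the set of integer sequences $(x_1,\dots,x_n)$ with $0\le x_\ell\le\ell-1$. A partition matrix on $[1,n]$ is a square upper triangular matrix whose entries are subsets of $[1,n]$ such that: (i) every row and column contains a non-empty entry; (ii) the non-empty entries partition $[1,n]$; (iii) $\mathrm{col}(i)<\mathrm{col}(j)$ implies $i<j$, where $\mathrm{col}(i)$ is the column index of the entry containing $i$. $\mathrm{Par}_n$ is the set of these; a matrix is diagonal if all off-diagonal entries are $\emptyset$. For $w\in\mathcal I_n$ with distinct entries $y_1<\dots<y_k$ and $y_{k+1}:=n$, $\Phi(w)$ is the $k\times k$ matrix whose $(i,j)$ entry is $\{\ell\in[1,n]: x_\ell=y_i\text{ and }y_j<\ell\le y_{j+1}\}$. The run-length encoding $\mathrm{RLE}(w)$ of a sequence $w$ is the list of pairs $(c_1,m_1)(c_2,m_2)\cdots(c_r,m_r)$ where $w$ consists of $m_1$ copies of $c_1$, then $m_2$ copies of $c_2$,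 etc., with $c_j\ne c_{j+1}$ (maximal runs of equal adjacent entries); e.g. $\mathrm{RLE}(0,0,0,0,1,1,0,2,3,3)=(0,4)(1,2)(0,1)(2,1)(3,2)$. -}

module Defs where

open import Data.Nat using (ℕ; zero; suc; _+_; _≤_; _<_; _≡ᵇ_; _<ᵇ_; _≤ᵇ_)
open import Data.Nat.Properties using (_≟_)
open import Data.Bool using (Bool; true; false; _∧_; if_then_else_)
open import Data.Fin using (Fin; toℕ)
open import Data.Fin.Subset using (Subset; _∈_; _∉_)
open import Data.Vec using (Vec; lookup; tabulate; toList; fromList)
open import Data.List using (List; []; _∷_; filter; length; upTo)
open import Data.Nat.ListAction using (sum)
open import Data.List.Relation.Unary.All using (All)
open import Data.List.Relation.Unary.Any as ListAny using ()
open import Data.Product using (Σ; ∃; ∃-syntax; _×_; _,_)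
open import Relation.Binary.PropositionalEquality using (_≡_)
open import Relation.Nullary using (¬_)

-- An element a ∈ [1,n] is represented by t : Fin n with a = toℕ t + 1.
-- A subset of [1,n] is a Subset n (= Vec Bool n) from Data.Fin.Subset.
-- A sequence (x_1,…,x_n) is a Vec ℕ n; x_ℓ is  lookup w t  with ℓ = toℕ t + 1.

Matrix : ℕ → Set
Matrix n = Σ ℕ (λ k → Vec (Vec (Subset n) k) k)

entry : ∀ {n k} → Vec (Vec (Subset n) k) k → Fin k → Fin k → Subset n
entry A i j = lookup (lookup A i) j

Empty : ∀ {n} → Subset n → Set
Empty {n} s = ∀ (a : Fin n) → a ∉ s

NonEmpty : ∀ {n} → Subset n → Set
NonEmpty {n} s = ∃[ a ] (a ∈ s)

record IsPartitionMatrix (n : ℕ) (M : Matrix n) : Set where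
  field
    upperTriangular : ∀ (i j : Fin (Σ.proj₁ M)) → toℕ j < toℕ i → Empty (entry (Σ.proj₂ M) i j)
    rowNonEmpty : ∀ (i : Fin (Σ.proj₁ M)) → ∃[ j ] NonEmpty (entry (Σ.proj₂ M) i j)
    colNonEmpty : ∀ (j : Fin (Σ.proj₁ M)) → ∃[ i ] NonEmpty (entry (Σ.proj₂ M) i j)
    covers : ∀ (a : Fin n) → ∃[ i ] ∃[ j ] (a ∈ entry (Σ.proj₂ M) i j)
    disjoint : ∀ (a : Fin n) (i j i' j' : Fin (Σ.proj₁ M)) →
               a ∈ entry (Σ.proj₂ M) i j → a ∈ entry (Σ.proj₂ M) i' j' →
               (i ≡ i') × (j ≡ j')
    colOrder : ∀ (a b : Fin n) (i j i' j' : Fin (Σ.proj₁ M)) →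
               a ∈ entry (Σ.proj₂ M) i j → b ∈ entry (Σ.proj₂ M) i' j' →
               toℕ j < toℕ j' → toℕ a < toℕ b

IsDiagonal : ∀ {n} → Matrix n → Set
IsDiagonal (k , A) = ∀ (i j : Fin k) → ¬ (i ≡ j) → Empty (entry A i j)

InI : ∀ {n} → Vec ℕ n → Set
InI {n} w = ∀ (t : Fin n) → lookup w t ≤ toℕ t

-- distinct values of w in increasing order (values are taken from [0,n-1],
-- which contains all entries of any w ∈ I_n)
distinctVals : ∀ {n} → Vec ℕ n → List ℕ
distinctVals {n} w = filter (λ v → ListAny.any? (v ≟_) (toList w)) (upTo n)

-- y_{j+1} for j ∈ [1,k] (0-based: index j ↦ next value, or n if last)
nextVal : ℕ → List ℕ → ℕ → ℕ
nextVal n [] j = n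
nextVal n (y ∷ []) zero = n
nextVal n (y ∷ z ∷ ys) zero = z
nextVal n (y ∷ ys) (suc j) = nextVal n ys j

Φ : ∀ {n} → Vec ℕ n → Matrix n
Φ {n} w = length ys , tabulate (λ i → tabulate (λ j → tabulate (λ t →
            let ℓ = suc (toℕ t) in
            (lookup w t ≡ᵇ lookup y i) ∧ (lookup y j <ᵇ ℓ) ∧ (ℓ ≤ᵇ nextVal n ys (toℕ j)))))
  where
    ys = distinctVals w
    y = fromList ys

rle : List ℕ → List (ℕ × ℕ)
rle [] = []
rle (x ∷ xs) with rle xs
... | [] = (x , 1) ∷ []
... | (c , m) ∷ rest = if x ≡ᵇ c then (c , suc m) ∷ rest else (x , 1) ∷ (c , m) ∷ rest

prefixPairs : ℕ → List ℕ → List (ℕ × ℕ)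
prefixPairs acc [] = []
prefixPairs acc (u ∷ us) = (acc , u) ∷ prefixPairs (acc + u) us

RLECondition : ∀ {n} → Vec ℕ n → Set
RLECondition {n} w =
  ∃[ us ] (1 ≤ length us × All (λ u → 1 ≤ u) us × sum us ≡ n ×
           rle (toList w) ≡ prefixPairs 0 us)

module Submission where

-- (1) Run-length encoding: rle w = (c₀,u₁)…(c_{k-1},u_k) holds iff w is the
--     staircase word of u₁,…,u_k (decode inverts rle; rle of a staircase).
-- (2) Cuts and blocks: position t of a staircase word holds c_i exactly when
--     c_i ≤ t < c_{i+1}, and its set of distinct values is {c₀,…,c_{k-1}}.
-- (3) Call a matrix block diagonal with cuts p when entry (i,j) is the block
--     [p i, p (i+1)) if i = j and empty otherwise.  Such a matrix is determined
--     by its size and p; for 0 = p 0 < … < p k = n it is a diagonal partition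
--     matrix; and Φ of a staircase word is block diagonal with its cuts.
-- (4) Conversely, in a diagonal partition matrix the column of an element is
--     monotone, so its columns are consecutive blocks; the block sizes give a
--     staircase word whose image under Φ is the matrix by (3).

open import Defs
open import Data.Nat using (ℕ; zero; suc; _+_; _∸_; _≤_; _<_; z≤n; s≤s; z<s; _≡ᵇ_; _<ᵇ_; _≤ᵇ_)
open import Data.Nat.Properties
open import Data.Nat.ListAction using (sum)
open import Data.Bool using (Bool; true; false; T; _∧_; if_then_else_)
open import Data.Bool.Properties using (T-≡; T-∧)
open import Data.Unit using (⊤; tt)
open import Data.Empty using (⊥; ⊥-elim)
open import Data.Fin as Fin using (Fin; toℕ; fromℕ<)
import Data.Fin.Properties as Fin
open import Data.Fin.Subset using (Subset; _∈_)
open import Data.Fin.Subset.Properties using (⊆-antisym)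
open import Data.Vec as Vec using (Vec; lookup; tabulate; toList; fromList)
import Data.Vec.Properties as Vec
open import Data.List using (List; []; _∷_; _++_; length; replicate; applyUpTo; upTo; filter)
import Data.List.Properties as List
open import Data.List.Relation.Unary.All as All using (All; []; _∷_)
open import Data.List.Relation.Unary.All.Properties using (replicate⁺)
open import Data.List.Relation.Unary.Any using (here; there; any?)
open import Data.List.Membership.Propositional using () renaming (_∈_ to _∈ₗ_)
open import Data.List.Membership.Propositional.Properties using (∈-++⁺ʳ; ∈-++⁻)
open import Data.Product using (∃-syntax; _×_; _,_; proj₁; proj₂)
open import Data.Sum using (inj₁; inj₂; [_,_]′)
open import Function using (_∘_)
open import Function.Bundles using (_⇔_; mk⇔; Equivalence)
import Function.Properties.Equivalence as ⇔
open import Data.Product.Function.NonDependent.Propositional using (_×-⇔_)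
open import Relation.Binary.PropositionalEquality
open import Relation.Binary.Definitions using (tri<; tri≈; tri>)
open import Relation.Nullary using (¬_; Dec; yes; no)

open Equivalence using (to; from)

-- Run-length encoding.

decode : List (ℕ × ℕ) → List ℕ
decode [] = []
decode ((c , m) ∷ r) = replicate m c ++ decode r

rleStep : ℕ → List (ℕ × ℕ) → List (ℕ × ℕ)
rleStep x [] = (x , 1) ∷ []
rleStep x ((c , m) ∷ r) = if x ≡ᵇ c then (c , suc m) ∷ r else (x , 1) ∷ (c , m) ∷ r

rle-∷ : ∀ x xs → rle (x ∷ xs) ≡ rleStep x (rle xs)
rle-∷ x xs with rle xs
... | [] = refl
... | (c , m) ∷ r = refl

decode-rleStep : ∀ x r → decode (rleStep x r) ≡ x ∷ decode r
decode-rleStep x [] = refl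
decode-rleStep x ((c , m) ∷ r) with x ≡ᵇ c in eq
... | true rewrite ≡ᵇ⇒≡ x c (from T-≡ eq) = refl
... | false = refl

decode∘rle : ∀ xs → decode (rle xs) ≡ xs
decode∘rle [] = refl
decode∘rle (x ∷ xs) = begin
  decode (rle (x ∷ xs))     ≡⟨ cong decode (rle-∷ x xs) ⟩
  decode (rleStep x (rle xs)) ≡⟨ decode-rleStep x (rle xs) ⟩
  x ∷ decode (rle xs)       ≡⟨ cong (x ∷_) (decode∘rle xs) ⟩
  x ∷ xs                    ∎
  where open ≡-Reasoning

staircase : ℕ → List ℕ → List ℕ
staircase acc us = decode (prefixPairs acc us)

Fresh : ℕ → List (ℕ × ℕ) → Set
Fresh a [] = ⊤
Fresh a ((c , _) ∷ _) = c ≢ a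

rleStep-fresh : ∀ a r → Fresh a r → rleStep a r ≡ (a , 1) ∷ r
rleStep-fresh a [] _ = refl
rleStep-fresh a ((c , m) ∷ r) c≢a with a ≡ᵇ c in eq
... | true = ⊥-elim (c≢a (sym (≡ᵇ⇒≡ a c (from T-≡ eq))))
... | false = refl

rle-replicate : ∀ u a rest → Fresh a (rle rest) →
  rle (replicate (suc u) a ++ rest) ≡ (a , suc u) ∷ rle rest
rle-replicate zero a rest fresh =
  trans (rle-∷ a rest) (rleStep-fresh a (rle rest) fresh)
rle-replicate (suc u) a rest fresh =
  trans (rle-∷ a (replicate (suc u) a ++ rest)) (trans (cong (rleStep a) (rle-replicate u a rest fresh)) extend)
  where
  extend : rleStep a ((a , suc u) ∷ rle rest) ≡ (a , suc (suc u)) ∷ rle rest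
  extend rewrite to T-≡ (≡⇒≡ᵇ a a refl) = refl

rle-staircase : ∀ acc us → All (1 ≤_) us → rle (staircase acc us) ≡ prefixPairs acc us
rle-staircase acc [] [] = refl
rle-staircase acc (suc u ∷ us) (_ ∷ pos) =
  trans (rle-replicate u acc (staircase next us) fresh)
        (cong ((acc , suc u) ∷_) (rle-staircase next us pos))
  where
  next : ℕ
  next = acc + suc u
  fresh-pairs : ∀ vs → Fresh acc (prefixPairs next vs)
  fresh-pairs [] = tt
  fresh-pairs (_ ∷ _) = m+1+n≢m acc
  fresh : Fresh acc (rle (staircase next us))
  fresh rewrite rle-staircase next us pos = fresh-pairs us

-- Cuts and blocks.

InBlock : (ℕ → ℕ) → ℕ → ℕ → Set
InBlock p i t = p i ≤ t × t < p (suc i)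

Monotone : (ℕ → ℕ) → Set
Monotone p = ∀ {a b} → a ≤ b → p a ≤ p b

inBlock-unique : ∀ {p} → Monotone p → ∀ {a b t} → InBlock p a t → InBlock p b t → a ≡ b
inBlock-unique mono {a} {b} (pa≤t , t<pa′) (pb≤t , t<pb′) with <-cmp a b
... | tri< a<b _ _ = ⊥-elim (<-irrefl refl (<-≤-trans t<pa′ (≤-trans (mono a<b) pb≤t)))
... | tri≈ _ a≡b _ = a≡b
... | tri> _ _ b<a = ⊥-elim (<-irrefl refl (<-≤-trans t<pb′ (≤-trans (mono b<a) pa≤t)))

findBlock : ∀ p m t → p 0 ≤ t → t < p m → ∃[ i ] (i < m × InBlock p i t)
findBlock p zero t p0≤t t<p0 = ⊥-elim (<⇒≱ t<p0 p0≤t)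
findBlock p (suc m) t p0≤t t<pm′ with p m ≤? t
... | yes pm≤t = m , ≤-refl , pm≤t , t<pm′
... | no pm≰t with findBlock p m t p0≤t (≰⇒> pm≰t)
...   | i , i<m , inBlock = i , m<n⇒m<1+n i<m , inBlock

cut : ℕ → List ℕ → ℕ → ℕ
cut acc us zero = acc
cut acc [] (suc i) = acc
cut acc (u ∷ us) (suc i) = cut (acc + u) us i

cut-≥ : ∀ acc us i → acc ≤ cut acc us i
cut-≥ acc us zero = ≤-refl
cut-≥ acc [] (suc i) = ≤-refl
cut-≥ acc (u ∷ us) (suc i) = ≤-trans (m≤m+n acc u) (cut-≥ (acc + u) us i)

cut-mono : ∀ acc us → Monotone (cut acc us)
cut-mono acc us {zero} {j} _ = cut-≥ acc us j
cut-mono acc [] {suc i} {suc j} _ = ≤-refl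
cut-mono acc (u ∷ us) {suc i} {suc j} (s≤s i≤j) = cut-mono (acc + u) us i≤j

cut-strict : ∀ acc us → All (1 ≤_) us → ∀ i → i < length us → cut acc us i < cut acc us (suc i)
cut-strict acc (u ∷ us) (1≤u ∷ _) zero _ = m<m+n acc 1≤u
cut-strict acc (u ∷ us) (_ ∷ pos) (suc i) (s≤s i<k) = cut-strict (acc + u) us pos i i<k

cut-last : ∀ acc us → cut acc us (length us) ≡ acc + sum us
cut-last acc [] = sym (+-identityʳ acc)
cut-last acc (u ∷ us) = trans (cut-last (acc + u) us) (+-assoc acc u (sum us))

blockStart : ℕ → List ℕ → ℕ → ℕ
blockStart acc [] t = acc
blockStart acc (u ∷ us) t with t <? acc + u
... | yes _ = acc
... | no _ = blockStart (acc + u) us t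

blockStart-≥ : ∀ acc us t → acc ≤ blockStart acc us t
blockStart-≥ acc [] t = ≤-refl
blockStart-≥ acc (u ∷ us) t with t <? acc + u
... | yes _ = ≤-refl
... | no _ = ≤-trans (m≤m+n acc u) (blockStart-≥ (acc + u) us t)

blockStart-≤ : ∀ acc us t → acc ≤ t → blockStart acc us t ≤ t
blockStart-≤ acc [] t acc≤t = acc≤t
blockStart-≤ acc (u ∷ us) t acc≤t with t <? acc + u
... | yes _ = acc≤t
... | no t≮ = blockStart-≤ (acc + u) us t (≮⇒≥ t≮)

blockStart-spec : ∀ acc us → All (1 ≤_) us → ∀ t i → i < length us → acc ≤ t →
  blockStart acc us t ≡ cut acc us i ⇔ InBlock (cut acc us) i t
blockStart-spec acc (u ∷ us) (1≤u ∷ pos) t i i<k acc≤t with t <? acc + u | i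
... | yes t<next | zero = mk⇔ (λ _ → acc≤t , t<next) (λ _ → refl)
... | yes t<next | suc i′ =
  mk⇔ (λ acc≡ → ⊥-elim (<-irrefl acc≡ (<-≤-trans (m<m+n acc 1≤u) (cut-≥ (acc + u) us i′))))
      (λ (cut≤t , _) → ⊥-elim (<⇒≱ t<next (≤-trans (cut-≥ (acc + u) us i′) cut≤t)))
... | no t≮next | zero =
  mk⇔ (λ start≡ → ⊥-elim (<-irrefl (sym start≡) (<-≤-trans (m<m+n acc 1≤u) (blockStart-≥ (acc + u) us t))))
      (λ (_ , t<next) → ⊥-elim (t≮next t<next))
... | no t≮next | suc i′ = blockStart-spec (acc + u) us pos t i′ (≤-pred i<k) (≮⇒≥ t≮next)

cuts : ℕ → List ℕ → List ℕ
cuts acc [] = []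
cuts acc (u ∷ us) = acc ∷ cuts (acc + u) us

length-cuts : ∀ acc us → length (cuts acc us) ≡ length us
length-cuts acc [] = refl
length-cuts acc (u ∷ us) = cong suc (length-cuts (acc + u) us)

lookup-cuts : ∀ acc us (i : Fin (length (cuts acc us))) →
  lookup (fromList (cuts acc us)) i ≡ cut acc us (toℕ i)
lookup-cuts acc (u ∷ us) Fin.zero = refl
lookup-cuts acc (u ∷ us) (Fin.suc i) = lookup-cuts (acc + u) us i

nextVal-cuts : ∀ acc us j → j < length us →
  nextVal (acc + sum us) (cuts acc us) j ≡ cut acc us (suc j)
nextVal-cuts acc (u ∷ []) zero _ = cong (acc +_) (+-identityʳ u)
nextVal-cuts acc (u ∷ u′ ∷ us) zero _ = refl
nextVal-cuts acc (u ∷ []) (suc j) (s≤s ())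
nextVal-cuts acc (u ∷ u′ ∷ us) (suc j) (s≤s j<k) =
  trans (cong (λ m → nextVal m (cuts (acc + u) (u′ ∷ us)) j) (sym (+-assoc acc u (sum (u′ ∷ us)))))
        (nextVal-cuts (acc + u) (u′ ∷ us) j j<k)

∈-cuts-≥ : ∀ {v} acc us → v ∈ₗ cuts acc us → acc ≤ v
∈-cuts-≥ acc (u ∷ us) (here refl) = ≤-refl
∈-cuts-≥ acc (u ∷ us) (there v∈) = ≤-trans (m≤m+n acc u) (∈-cuts-≥ (acc + u) us v∈)

-- Staircase words.

at : List ℕ → ℕ → ℕ
at [] _ = 0
at (x ∷ xs) zero = x
at (x ∷ xs) (suc r) = at xs r

lookup-at : ∀ {n} (w : Vec ℕ n) t → lookup w t ≡ at (toList w) (toℕ t)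
lookup-at (x Vec.∷ w) Fin.zero = refl
lookup-at (x Vec.∷ w) (Fin.suc t) = lookup-at w t

at-replicate-< : ∀ u a rest r → r < u → at (replicate u a ++ rest) r ≡ a
at-replicate-< (suc u) a rest zero _ = refl
at-replicate-< (suc u) a rest (suc r) (s≤s r<u) = at-replicate-< u a rest r r<u

at-replicate-≥ : ∀ u a rest r → u ≤ r → at (replicate u a ++ rest) r ≡ at rest (r ∸ u)
at-replicate-≥ zero a rest r _ = refl
at-replicate-≥ (suc u) a rest (suc r) (s≤s u≤r) = at-replicate-≥ u a rest r u≤r

at-staircase : ∀ acc us r → r < sum us → at (staircase acc us) r ≡ blockStart acc us (acc + r)
at-staircase acc (u ∷ us) r r<sum with acc + r <? acc + u
... | yes acc+r<next = at-replicate-< u acc _ r (+-cancelˡ-< acc r u acc+r<next)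
... | no acc+r≮next = begin
  at (replicate u acc ++ staircase (acc + u) us) r ≡⟨ at-replicate-≥ u acc _ r u≤r ⟩
  at (staircase (acc + u) us) (r ∸ u)            ≡⟨ at-staircase (acc + u) us (r ∸ u) r∸u<sum ⟩
  blockStart (acc + u) us (acc + u + (r ∸ u))    ≡⟨ cong (blockStart (acc + u) us) shift ⟩
  blockStart (acc + u) us (acc + r)              ∎
  where
  open ≡-Reasoning
  u≤r : u ≤ r
  u≤r = ≮⇒≥ (λ r<u → acc+r≮next (+-monoʳ-< acc r<u))
  shift : acc + u + (r ∸ u) ≡ acc + r
  shift = trans (+-assoc acc u (r ∸ u)) (cong (acc +_) (m+[n∸m]≡n u≤r))
  r∸u<sum : r ∸ u < sum us
  r∸u<sum = +-cancelˡ-< u (r ∸ u) (sum us) (subst (_< u + sum us) (sym (m+[n∸m]≡n u≤r)) r<sum)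

length-staircase : ∀ acc us → length (staircase acc us) ≡ sum us
length-staircase acc [] = refl
length-staircase acc (u ∷ us) =
  trans (List.length-++ (replicate u acc))
        (cong₂ _+_ (List.length-replicate u) (length-staircase (acc + u) us))

lookup-staircase : ∀ {n} (w : Vec ℕ n) us → sum us ≡ n → toList w ≡ staircase 0 us →
  ∀ t → lookup w t ≡ blockStart 0 us (toℕ t)
lookup-staircase w us sum≡n w≡ t =
  trans (lookup-at w t) (trans (cong (λ xs → at xs (toℕ t)) w≡)
        (at-staircase 0 us (toℕ t) (subst (toℕ t <_) (sym sum≡n) (Fin.toℕ<n t))))

∈-staircase : ∀ {v} acc us → All (1 ≤_) us → v ∈ₗ staircase acc us ⇔ v ∈ₗ cuts acc us
∈-staircase acc [] [] = mk⇔ (λ ()) (λ ())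
∈-staircase {v} acc (suc u ∷ us) (_ ∷ pos) = mk⇔ forward backward
  where
  block : List ℕ
  block = replicate (suc u) acc
  rest : v ∈ₗ staircase (acc + suc u) us ⇔ v ∈ₗ cuts (acc + suc u) us
  rest = ∈-staircase (acc + suc u) us pos
  forward : v ∈ₗ block ++ staircase (acc + suc u) us → v ∈ₗ cuts acc (suc u ∷ us)
  forward v∈ = [ (λ v∈block → here (All.lookup (replicate⁺ {P = _≡ acc} (suc u) refl) v∈block))
               , (λ v∈rest → there (to rest v∈rest)) ]′ (∈-++⁻ block v∈)
  backward : v ∈ₗ cuts acc (suc u ∷ us) → v ∈ₗ block ++ staircase (acc + suc u) us
  backward (here refl) = here refl
  backward (there v∈) = ∈-++⁺ʳ block (from rest v∈)

range : ℕ → ℕ → List ℕ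
range a zero = []
range a (suc m) = a ∷ range (suc a) m

upTo≡range : ∀ n → upTo n ≡ range 0 n
upTo≡range n = shifted n 0 (λ i → i) (λ _ → refl)
  where
  shifted : ∀ m a (f : ℕ → ℕ) → (∀ i → f i ≡ a + i) → applyUpTo f m ≡ range a m
  shifted zero a f f≡ = refl
  shifted (suc m) a f f≡ = cong₂ _∷_ (trans (f≡ 0) (+-identityʳ a))
    (shifted m (suc a) (f ∘ suc) (λ i → trans (f≡ (suc i)) (+-suc a i)))

range-++ : ∀ a u m → range a (u + m) ≡ range a u ++ range (a + u) m
range-++ a zero m = cong (λ b → range b m) (sym (+-identityʳ a))
range-++ a (suc u) m = cong (a ∷_) (trans (range-++ (suc a) u m)
  (cong (λ b → range (suc a) u ++ range b m) (sym (+-suc a u))))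

range-all : ∀ {R : ℕ → Set} a m → (∀ v → a ≤ v → v < a + m → R v) → All R (range a m)
range-all a zero _ = []
range-all a (suc m) R-in = R-in a ≤-refl (m<m+n a z<s)
  ∷ range-all (suc a) m (λ v a<v v<end → R-in v (<⇒≤ a<v) (subst (v <_) (sym (+-suc a m)) v<end))

filter-cuts : ∀ {Q : ℕ → Set} (Q? : ∀ v → Dec (Q v)) acc us → All (1 ≤_) us →
  (∀ v → acc ≤ v → Q v ⇔ v ∈ₗ cuts acc us) →
  filter Q? (range acc (sum us)) ≡ cuts acc us
filter-cuts Q? acc [] [] _ = refl
filter-cuts {Q} Q? acc (suc u ∷ us) (_ ∷ pos) Q⇔ = begin
  filter Q? (acc ∷ range (suc acc) (u + sum us))
    ≡⟨ List.filter-accept Q? (from (Q⇔ acc ≤-refl) (here refl)) ⟩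
  acc ∷ filter Q? (range (suc acc) (u + sum us))
    ≡⟨ cong (λ xs → acc ∷ filter Q? xs) (range-++ (suc acc) u (sum us)) ⟩
  acc ∷ filter Q? (range (suc acc) u ++ range (suc acc + u) (sum us))
    ≡⟨ cong (acc ∷_) (List.filter-++ Q? (range (suc acc) u) _) ⟩
  acc ∷ (filter Q? (range (suc acc) u) ++ filter Q? (range (suc acc + u) (sum us)))
    ≡⟨ cong (λ xs → acc ∷ (xs ++ filter Q? (range (suc acc + u) (sum us)))) (List.filter-none Q? gap) ⟩
  acc ∷ filter Q? (range (suc acc + u) (sum us))
    ≡⟨ cong (λ b → acc ∷ filter Q? (range b (sum us))) (sym (+-suc acc u)) ⟩
  acc ∷ filter Q? (range next (sum us))
    ≡⟨ cong (acc ∷_) (filter-cuts Q? next us pos Q⇔next) ⟩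
  acc ∷ cuts next us ∎
  where
  open ≡-Reasoning
  next : ℕ
  next = acc + suc u
  gap : All (¬_ ∘ Q) (range (suc acc) u)
  gap = range-all (suc acc) u λ v acc<v v<next Qv →
    case-cut v acc<v v<next (to (Q⇔ v (<⇒≤ acc<v)) Qv)
    where
    case-cut : ∀ v → acc < v → v < suc acc + u → v ∈ₗ cuts acc (suc u ∷ us) → ⊥
    case-cut v acc<v _ (here refl) = <-irrefl refl acc<v
    case-cut v _ v<next (there v∈) = <⇒≱ v<next (subst (_≤ v) (+-suc acc u) (∈-cuts-≥ next us v∈))
  Q⇔next : ∀ v → next ≤ v → Q v ⇔ v ∈ₗ cuts next us
  Q⇔next v next≤v = mk⇔ (drop-head ∘ to (Q⇔ v acc≤v)) (from (Q⇔ v acc≤v) ∘ there)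
    where
    acc≤v : acc ≤ v
    acc≤v = ≤-trans (m≤m+n acc (suc u)) next≤v
    drop-head : v ∈ₗ cuts acc (suc u ∷ us) → v ∈ₗ cuts next us
    drop-head (here refl) = ⊥-elim (<⇒≱ (m<m+n acc z<s) next≤v)
    drop-head (there v∈) = v∈

distinctVals-staircase : ∀ {n} (w : Vec ℕ n) us → All (1 ≤_) us → sum us ≡ n →
  toList w ≡ staircase 0 us → distinctVals w ≡ cuts 0 us
distinctVals-staircase {n} w us pos sum≡n w≡ = begin
  filter occurs? (upTo n)           ≡⟨ cong (filter occurs?) (upTo≡range n) ⟩
  filter occurs? (range 0 n)        ≡⟨ cong (λ m → filter occurs? (range 0 m)) (sym sum≡n) ⟩
  filter occurs? (range 0 (sum us)) ≡⟨ filter-cuts occurs? 0 us pos occurs⇔ ⟩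
  cuts 0 us                         ∎
  where
  open ≡-Reasoning
  occurs? : ∀ v → Dec (v ∈ₗ toList w)
  occurs? = λ v → any? (v ≟_) (toList w)
  occurs⇔ : ∀ v → 0 ≤ v → v ∈ₗ toList w ⇔ v ∈ₗ cuts 0 us
  occurs⇔ v _ = mk⇔ (to (∈-staircase 0 us pos) ∘ subst (v ∈ₗ_) w≡)
                    (subst (v ∈ₗ_) (sym w≡) ∘ from (∈-staircase 0 us pos))

-- Block-diagonal matrices.

BlockDiagonal : ∀ n → (ℕ → ℕ) → Matrix n → Set
BlockDiagonal n p (k , A) = ∀ (i j : Fin k) (t : Fin n) →
  t ∈ entry A i j ⇔ (i ≡ j × InBlock p (toℕ i) (toℕ t))

vec-ext : ∀ {A : Set} {m} {u v : Vec A m} → (∀ i → lookup u i ≡ lookup v i) → u ≡ v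
vec-ext {u = u} {v} same =
  trans (sym (Vec.tabulate∘lookup u)) (trans (Vec.tabulate-cong same) (Vec.tabulate∘lookup v))

blockDiagonal-unique : ∀ {n p} (M N : Matrix n) → proj₁ M ≡ proj₁ N →
  BlockDiagonal n p M → BlockDiagonal n p N → M ≡ N
blockDiagonal-unique (k , A) (.k , B) refl blocksA blocksB =
  cong (k ,_) (vec-ext λ i → vec-ext λ j →
    ⊆-antisym (from (blocksB i j _) ∘ to (blocksA i j _))
              (from (blocksA i j _) ∘ to (blocksB i j _)))

blockDiagonal-cong : ∀ {n k p q} {A : Vec (Vec (Subset n) k) k} → (∀ i → i ≤ k → p i ≡ q i) →
  BlockDiagonal n p (k , A) → BlockDiagonal n q (k , A)
blockDiagonal-cong p≡q blocks i j t =
  subst (λ (lo , hi) → t ∈ _ ⇔ (i ≡ j × lo ≤ toℕ t × toℕ t < hi))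
        (cong₂ _,_ (p≡q (toℕ i) (<⇒≤ (Fin.toℕ<n i))) (p≡q (suc (toℕ i)) (Fin.toℕ<n i)))
        (blocks i j t)

-- Strictly increasing cuts from 0 to n make a block-diagonal matrix a
-- diagonal partition matrix: every block is non-empty, the blocks tile
-- [0,n), and later columns hold later blocks.
blockDiagonal⇒diagonalPartition : ∀ {n k p} {A : Vec (Vec (Subset n) k) k} →
  Monotone p → (∀ i → i < k → p i < p (suc i)) → p 0 ≡ 0 → p k ≡ n →
  BlockDiagonal n p (k , A) → IsPartitionMatrix n (k , A) × IsDiagonal (k , A)
blockDiagonal⇒diagonalPartition {n} {k} {p} {A} mono strict p0≡0 pk≡n blocks =
  record
    { upperTriangular = λ i j j<i t t∈ → <-irrefl (cong toℕ (sym (diagonalOnly t∈))) j<i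
    ; rowNonEmpty = λ i → i , firstOf i , firstOf∈ i
    ; colNonEmpty = λ j → j , firstOf j , firstOf∈ j
    ; covers = covers
    ; disjoint = λ t i j i′ j′ t∈ t∈′ →
        let same = sameBlock t∈ t∈′ in
        same , trans (sym (diagonalOnly t∈)) (trans same (diagonalOnly t∈′))
    ; colOrder = λ a b i j i′ j′ a∈ b∈ j<j′ →
        <-≤-trans (proj₂ (blockOf a∈)) (≤-trans (mono (subst₂ (λ x y → suc (toℕ x) ≤ toℕ y)
          (sym (diagonalOnly a∈)) (sym (diagonalOnly b∈)) j<j′)) (proj₁ (blockOf b∈)))
    }
  , λ i j i≢j t t∈ → i≢j (diagonalOnly t∈)
  where
  diagonalOnly : ∀ {i j t} → t ∈ entry A i j → i ≡ j
  diagonalOnly {i} {j} {t} t∈ = proj₁ (to (blocks i j t) t∈)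
  blockOf : ∀ {i j t} → t ∈ entry A i j → InBlock p (toℕ i) (toℕ t)
  blockOf {i} {j} {t} t∈ = proj₂ (to (blocks i j t) t∈)
  sameBlock : ∀ {i j i′ j′ t} → t ∈ entry A i j → t ∈ entry A i′ j′ → i ≡ i′
  sameBlock t∈ t∈′ = Fin.toℕ-injective (inBlock-unique mono (blockOf t∈) (blockOf t∈′))
  first<n : (i : Fin k) → p (toℕ i) < n
  first<n i = <-≤-trans (strict (toℕ i) (Fin.toℕ<n i)) (subst (_ ≤_) pk≡n (mono (Fin.toℕ<n i)))
  firstOf : Fin k → Fin n
  firstOf i = fromℕ< (first<n i)
  firstOf∈ : ∀ i → firstOf i ∈ entry A i i
  firstOf∈ i = from (blocks i i (firstOf i)) (refl , first≤ , first<)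
    where
    first≤ : p (toℕ i) ≤ toℕ (firstOf i)
    first≤ = ≤-reflexive (sym (Fin.toℕ-fromℕ< (first<n i)))
    first< : toℕ (firstOf i) < p (suc (toℕ i))
    first< = subst (_< p (suc (toℕ i))) (sym (Fin.toℕ-fromℕ< (first<n i))) (strict (toℕ i) (Fin.toℕ<n i))
  covers : ∀ t → ∃[ i ] ∃[ j ] (t ∈ entry A i j)
  covers t with findBlock p k (toℕ t) (subst (_≤ toℕ t) (sym p0≡0) z≤n)
                                      (subst (toℕ t <_) (sym pk≡n) (Fin.toℕ<n t))
  ... | i , i<k , inBlock = fi , fi , from (blocks fi fi t) (refl , inBlock′)
    where
    fi : Fin k
    fi = fromℕ< i<k
    inBlock′ : InBlock p (toℕ fi) (toℕ t)
    inBlock′ = subst (λ x → InBlock p x (toℕ t)) (sym (Fin.toℕ-fromℕ< i<k)) inBlock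

ΦWith : ∀ {n} → Vec ℕ n → List ℕ → Matrix n
ΦWith {n} w ys = length ys , tabulate (λ i → tabulate (λ j → tabulate (λ t →
  (lookup w t ≡ᵇ lookup (fromList ys) i) ∧ (lookup (fromList ys) j <ᵇ suc (toℕ t)) ∧
  (suc (toℕ t) ≤ᵇ nextVal n ys (toℕ j)))))

∈-tabulated : ∀ {n k} (f : Fin k → Fin k → Fin n → Bool) i j t →
  t ∈ entry (tabulate (λ i → tabulate (λ j → tabulate (f i j)))) i j ⇔ T (f i j t)
∈-tabulated f i j t = mk⇔ (λ t∈ → subst T entry≡ (from T-≡ (Vec.[]=⇒lookup t∈)))
                          (λ ft → Vec.lookup⇒[]= t _ (to T-≡ (subst T (sym entry≡) ft)))
  where
  entry≡ : lookup (entry (tabulate (λ i → tabulate (λ j → tabulate (f i j)))) i j) t ≡ f i j t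
  entry≡ = trans (cong (λ row → lookup (lookup row j) t) (Vec.lookup∘tabulate _ i))
           (trans (cong (λ col → lookup col t) (Vec.lookup∘tabulate _ j)) (Vec.lookup∘tabulate _ t))

bothBlocks⇔ : ∀ {p k} → Monotone p → ∀ (i j : Fin k) t →
  (InBlock p (toℕ i) t × InBlock p (toℕ j) t) ⇔ (i ≡ j × InBlock p (toℕ i) t)
bothBlocks⇔ mono i j t = mk⇔
  (λ (inI , inJ) → Fin.toℕ-injective (inBlock-unique mono inI inJ) , inI)
  (λ { (refl , inI) → inI , inI })

Φ-staircase : ∀ {n} (w : Vec ℕ n) us → All (1 ≤_) us → sum us ≡ n → toList w ≡ staircase 0 us →
  proj₁ (Φ w) ≡ length us × BlockDiagonal n (cut 0 us) (Φ w)
Φ-staircase {n} w us pos sum≡n w≡ =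
  subst (λ M → proj₁ M ≡ length us × BlockDiagonal n c M)
        (cong (ΦWith w) (sym (distinctVals-staircase w us pos sum≡n w≡)))
        (length-cuts 0 us , blocks)
  where
  c : ℕ → ℕ
  c = cut 0 us
  ys : List ℕ
  ys = cuts 0 us
  below : (i : Fin (length ys)) → toℕ i < length us
  below i = subst (toℕ i <_) (length-cuts 0 us) (Fin.toℕ<n i)
  next≡ : (j : Fin (length ys)) → nextVal n ys (toℕ j) ≡ c (suc (toℕ j))
  next≡ j = trans (cong (λ m → nextVal m ys (toℕ j)) (sym sum≡n)) (nextVal-cuts 0 us (toℕ j) (below j))
  valueTest : ∀ i t → T (lookup w t ≡ᵇ lookup (fromList ys) i) ⇔ InBlock c (toℕ i) (toℕ t)
  valueTest i t = ⇔.trans (mk⇔ (≡ᵇ⇒≡ _ _) (≡⇒≡ᵇ _ _))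
    (subst₂ (λ x y → (x ≡ y) ⇔ InBlock c (toℕ i) (toℕ t))
      (sym (lookup-staircase w us sum≡n w≡ t)) (sym (lookup-cuts 0 us i))
      (blockStart-spec 0 us pos (toℕ t) (toℕ i) (below i) z≤n))
  positionTest : ∀ j t → (T (lookup (fromList ys) j <ᵇ suc (toℕ t)) × T (suc (toℕ t) ≤ᵇ nextVal n ys (toℕ j)))
                         ⇔ InBlock c (toℕ j) (toℕ t)
  positionTest j t rewrite lookup-cuts 0 us j | next≡ j =
    mk⇔ (λ (lo , hi) → ≤-pred (<ᵇ⇒< _ _ lo) , ≤ᵇ⇒≤ _ _ hi)
        (λ (lo , hi) → <⇒<ᵇ (s≤s lo) , ≤⇒≤ᵇ hi)
  blocks : BlockDiagonal n c (ΦWith w ys)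
  blocks i j t = ⇔.trans (∈-tabulated _ i j t)
    (⇔.trans T-∧ (⇔.trans (valueTest i t ×-⇔ ⇔.trans T-∧ (positionTest j t))
      (bothBlocks⇔ (cut-mono 0 us) i j (toℕ t))))

-- Diagonal partition matrices are block diagonal.

threshold : ∀ {m} (Q : Fin m → Set) → (∀ t → Dec (Q t)) → (∀ {a b} → toℕ a ≤ toℕ b → Q a → Q b) →
  ∃[ q ] (q ≤ m × ∀ t → Q t ⇔ q ≤ toℕ t)
threshold {zero} Q Q? upward = 0 , z≤n , λ ()
threshold {suc m} Q Q? upward with Q? Fin.zero
... | yes Q0 = 0 , z≤n , λ t → mk⇔ (λ _ → z≤n) (λ _ → upward z≤n Q0)
... | no ¬Q0 with threshold (Q ∘ Fin.suc) (Q? ∘ Fin.suc) (λ a≤b → upward (s≤s a≤b))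
...   | q , q≤m , Q⇔ = suc q , s≤s q≤m , λ
  { Fin.zero → mk⇔ (⊥-elim ∘ ¬Q0) (λ ())
  ; (Fin.suc t) → mk⇔ (s≤s ∘ to (Q⇔ t)) (from (Q⇔ t) ∘ ≤-pred) }

differences : (ℕ → ℕ) → ℕ → List ℕ
differences p zero = []
differences p (suc m) = (p 1 ∸ p 0) ∷ differences (p ∘ suc) m

length-differences : ∀ p m → length (differences p m) ≡ m
length-differences p zero = refl
length-differences p (suc m) = cong suc (length-differences (p ∘ suc) m)

differences-positive : ∀ p m → (∀ i → i < m → p i < p (suc i)) → All (1 ≤_) (differences p m)
differences-positive p zero _ = []
differences-positive p (suc m) strict =
  m<n⇒0<n∸m (strict 0 z<s) ∷ differences-positive (p ∘ suc) m (λ i i<m → strict (suc i) (s≤s i<m))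

cut-differences : ∀ p m → (∀ i → i < m → p i ≤ p (suc i)) → ∀ i → i ≤ m → cut (p 0) (differences p m) i ≡ p i
cut-differences p m _ zero _ = refl
cut-differences p (suc m) increasing (suc i) (s≤s i≤m) =
  trans (cong (λ a → cut a (differences (p ∘ suc) m) i) (m+[n∸m]≡n (increasing 0 z<s)))
        (cut-differences (p ∘ suc) m (λ j j<m → increasing (suc j) (s≤s j<m)) i i≤m)

-- In a diagonal partition matrix every element lies on the diagonal in the
-- column col t; col is monotone and onto, so column j is the block of
-- positions between the thresholds p j = min {t : j ≤ col t} and p (j+1).
module DiagonalPartition {n k : ℕ} (1≤n : 1 ≤ n) {A : Vec (Vec (Subset n) k) k}
         (part : IsPartitionMatrix n (k , A)) (diag : IsDiagonal (k , A)) where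
  open IsPartitionMatrix part

  onDiagonal : ∀ t → ∃[ j ] (t ∈ entry A j j)
  onDiagonal t with covers t
  ... | i , j , t∈ with i Fin.≟ j
  ...   | yes refl = i , t∈
  ...   | no i≢j = ⊥-elim (diag i j i≢j t t∈)

  col : Fin n → Fin k
  col t = proj₁ (onDiagonal t)

  col-unique : ∀ {t i j} → t ∈ entry A i j → i ≡ col t × j ≡ col t
  col-unique {t} t∈ = disjoint t _ _ _ _ t∈ (proj₂ (onDiagonal t))

  col-mono : ∀ {a b} → toℕ a ≤ toℕ b → toℕ (col a) ≤ toℕ (col b)
  col-mono {a} {b} a≤b = ≮⇒≥ λ colb<cola →
    <⇒≱ (colOrder b a _ _ _ _ (proj₂ (onDiagonal b)) (proj₂ (onDiagonal a)) colb<cola) a≤b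

  col-onto : ∀ j → ∃[ t ] (col t ≡ j)
  col-onto j with colNonEmpty j
  ... | _ , t , t∈ = t , sym (proj₂ (col-unique t∈))

  cutAt : ∀ j → ∃[ q ] (q ≤ n × ∀ t → j ≤ toℕ (col t) ⇔ q ≤ toℕ t)
  cutAt j = threshold (λ t → j ≤ toℕ (col t)) (λ t → j ≤? toℕ (col t)) (λ a≤b j≤ → ≤-trans j≤ (col-mono a≤b))

  p : ℕ → ℕ
  p j = proj₁ (cutAt j)

  p-spec : ∀ j t → j ≤ toℕ (col t) ⇔ p j ≤ toℕ t
  p-spec j = proj₂ (proj₂ (cutAt j))

  inBlock⇔col : ∀ j t → InBlock p j (toℕ t) ⇔ toℕ (col t) ≡ j
  inBlock⇔col j t = mk⇔
    (λ (lo , hi) → ≤-antisym (≮⇒≥ (λ j<col → <⇒≱ hi (to (p-spec (suc j) t) j<col))) (from (p-spec j t) lo))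
    (λ { refl → to (p-spec _ t) ≤-refl , ≰⇒> (λ hi → <-irrefl refl (from (p-spec _ t) hi)) })

  p0≡0 : p 0 ≡ 0
  p0≡0 = n≤0⇒n≡0 (subst (p 0 ≤_) (Fin.toℕ-fromℕ< 1≤n) (to (p-spec 0 (fromℕ< 1≤n)) z≤n))

  pk≡n : p k ≡ n
  pk≡n with m≤n⇒m<n∨m≡n (proj₁ (proj₂ (cutAt k)))
  ... | inj₂ pk≡n = pk≡n
  ... | inj₁ pk<n = ⊥-elim (<⇒≱ (Fin.toℕ<n (col t)) (from (p-spec k t) (≤-reflexive (sym (Fin.toℕ-fromℕ< pk<n)))))
    where
    t : Fin n
    t = fromℕ< pk<n

  p-strict : ∀ i → i < k → p i < p (suc i)
  p-strict i i<k with col-onto (fromℕ< i<k)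
  ... | t , colt≡ = ≤-<-trans (proj₁ inBlock) (proj₂ inBlock)
    where
    inBlock : InBlock p i (toℕ t)
    inBlock = from (inBlock⇔col i t) (trans (cong toℕ colt≡) (Fin.toℕ-fromℕ< i<k))

  blockDiagonal : BlockDiagonal n p (k , A)
  blockDiagonal i j t = mk⇔
    (λ t∈ → let (i≡ , j≡) = col-unique t∈ in
             trans i≡ (sym j≡) , from (inBlock⇔col (toℕ i) t) (cong toℕ (sym i≡)))
    (λ { (refl , inBlock) → subst (λ c → t ∈ entry A c c)
           (Fin.toℕ-injective (to (inBlock⇔col (toℕ i) t) inBlock)) (proj₂ (onDiagonal t)) })

diagonalPartition⇒blockDiagonal : ∀ {n k} {A : Vec (Vec (Subset n) k) k} → 1 ≤ n →
  IsPartitionMatrix n (k , A) → IsDiagonal (k , A) →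
  ∃[ us ] (All (1 ≤_) us × length us ≡ k × sum us ≡ n × BlockDiagonal n (cut 0 us) (k , A))
diagonalPartition⇒blockDiagonal {n} {k} {A} 1≤n part diag =
  us , differences-positive p k p-strict , length-differences p k , sum≡n ,
  blockDiagonal-cong {A = A} (λ i i≤k → sym (cut≡p i i≤k)) blockDiagonal
  where
  open DiagonalPartition 1≤n part diag
  us : List ℕ
  us = differences p k
  cut≡p : ∀ i → i ≤ k → cut 0 us i ≡ p i
  cut≡p i i≤k = subst (λ a → cut a us i ≡ p i) p0≡0
                  (cut-differences p k (λ j j<k → <⇒≤ (p-strict j j<k)) i i≤k)
  sum≡n : sum us ≡ n
  sum≡n = begin
    sum us                ≡⟨ cut-last 0 us ⟨
    cut 0 us (length us)  ≡⟨ cong (cut 0 us) (length-differences p k) ⟩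
    cut 0 us k            ≡⟨ cut≡p k ≤-refl ⟩
    p k                   ≡⟨ pk≡n ⟩
    n                     ∎
    where open ≡-Reasoning

staircaseVec : ∀ {n} us → sum us ≡ n → Vec ℕ n
staircaseVec us sum≡n = subst (Vec ℕ) (trans (length-staircase 0 us) sum≡n) (fromList (staircase 0 us))

toList-staircaseVec : ∀ {n} us (sum≡n : sum us ≡ n) → toList (staircaseVec us sum≡n) ≡ staircase 0 us
toList-staircaseVec us sum≡n = trans (toList-subst (trans (length-staircase 0 us) sum≡n)) (Vec.toList∘fromList _)
  where
  toList-subst : ∀ {m n} {v : Vec ℕ m} (m≡n : m ≡ n) → toList (subst (Vec ℕ) m≡n v) ≡ toList v
  toList-subst refl = refl

-- Every staircase word lies in I_n: position t holds a cut at most t.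
staircase-inI : ∀ {n} (w : Vec ℕ n) us → sum us ≡ n → toList w ≡ staircase 0 us → InI {n} w
staircase-inI w us sum≡n w≡ t =
  subst (_≤ toℕ t) (sym (lookup-staircase w us sum≡n w≡ t)) (blockStart-≤ 0 us (toℕ t) z≤n)

nonEmpty : ∀ us → 1 ≤ sum us → 1 ≤ length us
nonEmpty (_ ∷ _) _ = s≤s z≤n

corollary11 : ∀ (n : ℕ) → 1 ≤ n → (M : Matrix n) →
    (IsPartitionMatrix n M × IsDiagonal M) ⇔
    (∃[ w ] (InI {n} w × RLECondition w × Φ w ≡ M))
corollary11 n 1≤n (k , A) = mk⇔ fromMatrix toMatrix
  where
  fromMatrix : IsPartitionMatrix n (k , A) × IsDiagonal (k , A) →
               ∃[ w ] (InI {n} w × RLECondition w × Φ w ≡ (k , A))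
  fromMatrix (part , diag) with diagonalPartition⇒blockDiagonal 1≤n part diag
  ... | us , pos , length≡k , sum≡n , blocks =
    w , staircase-inI w us sum≡n w≡
      , (us , nonEmpty us (subst (1 ≤_) (sym sum≡n) 1≤n) , pos , sum≡n
            , trans (cong rle w≡) (rle-staircase 0 us pos))
      , blockDiagonal-unique {p = cut 0 us} (Φ w) (k , A) (trans (proj₁ Φw) length≡k) (proj₂ Φw) blocks
    where
    w : Vec ℕ n
    w = staircaseVec us sum≡n
    w≡ : toList w ≡ staircase 0 us
    w≡ = toList-staircaseVec us sum≡n
    Φw : proj₁ (Φ w) ≡ length us × BlockDiagonal n (cut 0 us) (Φ w)
    Φw = Φ-staircase w us pos sum≡n w≡
  toMatrix : ∃[ w ] (InI {n} w × RLECondition w × Φ w ≡ (k , A)) →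
             IsPartitionMatrix n (k , A) × IsDiagonal (k , A)
  toMatrix (w , _ , (us , _ , pos , sum≡n , rle≡) , refl) =
    blockDiagonal⇒diagonalPartition (cut-mono 0 us) strict refl last (proj₂ Φw)
    where
    w≡ : toList w ≡ staircase 0 us
    w≡ = trans (sym (decode∘rle (toList w))) (cong decode rle≡)
    Φw : proj₁ (Φ w) ≡ length us × BlockDiagonal n (cut 0 us) (Φ w)
    Φw = Φ-staircase w us pos sum≡n w≡
    strict : ∀ i → i < proj₁ (Φ w) → cut 0 us i < cut 0 us (suc i)
    strict i i<k = cut-strict 0 us pos i (subst (i <_) (proj₁ Φw) i<k)
    last : cut 0 us (proj₁ (Φ w)) ≡ n
    last = trans (cong (cut 0 us) (proj₁ Φw)) (trans (cut-last 0 us) sum≡n)
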